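{- If $k\ge 2$ and $n_i\ge 3$ for all $i\in\{1,\dots,k\}$, then $\mu^{ - }_t(P_{n_1}\,\square\,\cdots\,\square\, P_{n_k})=2^k$.
   Context: $P_n$ is the path on $n$ vertices and $\square$ is the Cartesian product of graphs: $V(G\square H)=V(G)\times V(H)$, with $(g,h)(g',h')$ an edge iff ($g=g'$ and $hh'\in E(H)$) or ($gg'\in E(G)$ and $h=h'$). For $X\subseteq V(G)$, two vertices $a,b$ are $X$-visible if there is a shortest $a,b$-path $P$ with $V(P)\cap X\subseteq\{a,b\}$. $X$ is a total mutual-visibility set if every two vertices of $G$ are $X$-visible; it is maximal if no proper superset is one. $\mu^{ - }_t(G)$ is the minimum cardinality of a maximal total mutual-visibility set. -}

module Defs where

open import Data.Nat using (ℕ; zero; suc; _≤_)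
open import Data.Fin using (Fin; toℕ)
open import Data.Product using (_×_; _,_; Σ; ∃)
open import Data.Sum using (_⊎_)
open import Data.List using (List; []; _∷_; length)
open import Data.List.Membership.Propositional using (_∈_; _∉_)
open import Data.List.Relation.Unary.All using (All)
open import Data.List.Relation.Unary.Unique.Propositional using (Unique)
open import Data.Vec using (Vec; []; _∷_)
open import Relation.Binary.PropositionalEquality using (_≡_)
open import Relation.Nullary using (¬_)

record Graph : Set₁ where
  field
    V   : Set
    Adj : V → V → Set
open Graph public

P : ℕ → Graph
P n = record { V = Fin n
             ; Adj = λ i j → (toℕ j ≡ suc (toℕ i)) ⊎ (toℕ i ≡ suc (toℕ j)) }

_□_ : Graph → Graph → Graph
G □ H = record
  { V = V G × V H
  ; Adj = λ { (g , h) (g' , h') → (g ≡ g' × Adj H h h') ⊎ (Adj G g g' × h ≡ h') } }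

□Paths : ∀ {m} → Vec ℕ (suc m) → Graph
□Paths (n ∷ [])          = P n
□Paths (n ∷ (n' ∷ ns))   = P n □ □Paths (n' ∷ ns)

data Walk (G : Graph) : V G → V G → ℕ → Set where
  nil  : ∀ {a} → Walk G a a 0
  cons : ∀ {a b c n} → Adj G a b → Walk G b c n → Walk G a c (suc n)

verts : ∀ {G a b n} → Walk G a b n → List (V G)
verts {a = a} nil        = a ∷ []
verts {a = a} (cons _ w) = a ∷ verts w

-- A shortest a,b-walk (necessarily a path): no a,b-walk is shorter.
IsShortest : ∀ {G a b n} → Walk G a b n → Set
IsShortest {G} {a} {b} {n} _ = ∀ {m} → Walk G a b m → n ≤ m

Visible : (G : Graph) → List (V G) → V G → V G → Set
Visible G X a b =
  Σ ℕ λ n → Σ (Walk G a b n) λ p →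
    IsShortest p × All (λ v → v ∈ X → (v ≡ a) ⊎ (v ≡ b)) (verts p)

-- Vertex subsets are duplicate-free lists of vertices.
-- Total mutual-visibility set: every two vertices of G are X-visible.
IsTMV : (G : Graph) → List (V G) → Set
IsTMV G X = Unique X × (∀ a b → Visible G X a b)

_⊆_ : ∀ {A : Set} → List A → List A → Set
X ⊆ Y = ∀ {v} → v ∈ X → v ∈ Y

IsMaximalTMV : (G : Graph) → List (V G) → Set
IsMaximalTMV G X =
  IsTMV G X ×
  (∀ Y → Unique Y → X ⊆ Y → (∃ λ v → v ∈ Y × v ∉ X) → ¬ IsTMV G Y)

μ⁻t≡ : Graph → ℕ → Set
μ⁻t≡ G c =
  (Σ (List (V G)) λ X → IsMaximalTMV G X × length X ≡ c) ×
  (∀ X → IsMaximalTMV G X → c ≤ length X)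

-- A vertex of P_{n₁} □ ⋯ □ P_{n_k} is a corner if every coordinate is an end of its path.
-- A non-corner v has a coordinate in which it is interior; its two neighbours a, b along that
-- coordinate are at distance 2 and v is their only common neighbour, so v lies on every a,b-geodesic
-- and cannot belong to a total mutual-visibility set. Conversely the 2^k corners form one: to join
-- (x , h) to (y , h') move the first coordinate from x to an interior value p between x and y
-- (this is where n₁ ≥ 3 is used), adjust the other coordinates recursively while sitting at p,
-- then finish at y; the ℓ¹ distance shows this walk is a geodesic, and its inner vertices are
-- not corners. Hence the corners form the largest total mutual-visibility set, which is then
-- contained in every maximal one.

module Submission where

open import Defs
open import Data.Nat using (ℕ; zero; suc; _≤_; _<_; _^_; _+_; _*_; _∸_; ∣_-_∣; z≤n; s≤s; s≤s⁻¹; _≤?_; _≟_)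
open import Data.Nat.Properties
open import Data.Fin as Fin using (Fin; toℕ; fromℕ<; fromℕ) renaming (_≟_ to _≟ᶠ_)
open import Data.Fin.Properties using (toℕ-injective; toℕ-fromℕ<; toℕ-fromℕ; toℕ<n)
open import Data.Vec using (Vec; []; _∷_)
open import Data.Vec.Relation.Unary.All as All using (All; []; _∷_)
open import Data.List using (List; []; _∷_; length; _++_; map; cartesianProduct)
import Data.List.Relation.Unary.All as List
import Data.List.Relation.Unary.All.Properties as List
open import Data.List.Relation.Unary.AllPairs using ([]; _∷_)
open import Data.List.Relation.Unary.Any using (here; there)
open import Data.List.Membership.Propositional using (_∈_)
open import Data.List.Membership.Propositional.Properties
  using (∈-++⁺ˡ; ∈-++⁺ʳ; ∈-++⁻; ∈-∃++; ∈-cartesianProduct⁺; ∈-cartesianProduct⁻)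
open import Data.List.Membership.DecPropositional using (_∈?_)
open import Data.List.Relation.Unary.Unique.Propositional using (Unique)
import Data.List.Relation.Unary.Unique.Propositional.Properties as Unique
open import Data.List.Properties using (length-++; length-map)
open import Data.Product using (Σ; ∃; _×_; _,_; proj₁; proj₂; map₂)
open import Data.Product.Properties using (≡-dec)
open import Data.Sum as Sum using (_⊎_; inj₁; inj₂; [_,_]; swap)
open import Data.Empty using (⊥-elim)
open import Function using (_∘_)
open import Relation.Nullary using (¬_; Dec; yes; no)
open import Relation.Nullary.Decidable using (_⊎-dec_; _×-dec_)
open import Relation.Unary using (_⟨×⟩_)
open import Relation.Binary.Definitions using (DecidableEquality; tri<; tri≈; tri>)
open import Relation.Binary.PropositionalEquality hiding ([_])

private variable
  G H : Graph
  k l : ℕ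

_++ʷ_ : ∀ {a b c} → Walk G a b k → Walk G b c l → Walk G a c (k + l)
nil       ++ʷ w = w
cons e v  ++ʷ w = cons e (v ++ʷ w)

All-verts-++ʷ : ∀ {Q : V G → Set} {a b c} (w₁ : Walk G a b k) (w₂ : Walk G b c l) →
                List.All Q (verts w₁) → List.All Q (verts w₂) → List.All Q (verts (w₁ ++ʷ w₂))
All-verts-++ʷ nil         w₂ _               q₂ = q₂
All-verts-++ʷ (cons e w₁) w₂ (q List.∷ q₁) q₂ = q List.∷ All-verts-++ʷ w₁ w₂ q₁ q₂

record Hom (G H : Graph) : Set where
  field
    vertex : V G → V H
    edge   : ∀ {a b} → Adj G a b → Adj H (vertex a) (vertex b)
open Hom

mapʷ : (φ : Hom G H) → ∀ {a b} → Walk G a b k → Walk H (vertex φ a) (vertex φ b) k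
mapʷ φ nil        = nil
mapʷ φ (cons e w) = cons (edge φ e) (mapʷ φ w)

verts-mapʷ : (φ : Hom G H) → ∀ {a b} (w : Walk G a b k) → verts (mapʷ φ w) ≡ map (vertex φ) (verts w)
verts-mapʷ φ nil        = refl
verts-mapʷ φ (cons e w) = cong (vertex φ _ ∷_) (verts-mapʷ φ w)

All-verts-mapʷ : ∀ {Q : V H → Set} (φ : Hom G H) {a b} (w : Walk G a b k) →
                 List.All (Q ∘ vertex φ) (verts w) → List.All Q (verts (mapʷ φ w))
All-verts-mapʷ φ w q = subst (List.All _) (sym (verts-mapʷ φ w)) (List.map⁺ q)

castʷ : ∀ {a b} → k ≡ l → Walk G a b k → Walk G a b l
castʷ refl w = w

verts-castʷ : ∀ {a b} (eq : k ≡ l) (w : Walk G a b k) → verts (castʷ eq w) ≡ verts w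
verts-castʷ refl w = refl

□-fibreˡ : V H → Hom G (G □ H)
□-fibreˡ h = record { vertex = _, h ; edge = λ e → inj₂ (e , refl) }

□-fibreʳ : V G → Hom H (G □ H)
□-fibreʳ x = record { vertex = x ,_ ; edge = λ e → inj₁ (refl , e) }

OnlyAtEnds : {A : Set} → (A → Set) → A → A → A → Set
OnlyAtEnds Q a b v = Q v → v ≡ a ⊎ v ≡ b

WalkWithin : (G : Graph) → (V G → Set) → V G → V G → ℕ → Set
WalkWithin G Q a b k = Σ (Walk G a b k) λ w → List.All Q (verts w)

castWithin : ∀ {Q a b} → k ≡ l → WalkWithin G Q a b k → WalkWithin G Q a b l
castWithin eq (w , inQ) = castʷ eq w , subst (List.All _) (sym (verts-castʷ eq w)) inQ

AvoidingWalk : (G : Graph) → (V G → Set) → V G → V G → ℕ → Set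
AvoidingWalk G Q a b = WalkWithin G (OnlyAtEnds Q a b) a b

StepBounded : (G : Graph) → (V G → V G → ℕ) → Set
StepBounded G d = ∀ a b c → Adj G a b → d a c ≤ suc (d b c)

dist≤length : ∀ {d : V G → V G → ℕ} → (∀ a → d a a ≡ 0) → StepBounded G d →
              ∀ {a b} → Walk G a b k → d a b ≤ k
dist≤length d-refl step {a} nil        = ≤-reflexive (d-refl a)
dist≤length d-refl step     (cons e w) = ≤-trans (step _ _ _ e) (s≤s (dist≤length d-refl step w))

_⊕_ : {A B : Set} → (A → A → ℕ) → (B → B → ℕ) → A × B → A × B → ℕ
(d ⊕ d') (x , h) (y , h') = d x y + d' h h'

⊕-stepBounded : ∀ {d d'} → StepBounded G d → StepBounded H d' → StepBounded (G □ H) (d ⊕ d')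
⊕-stepBounded step step' (x , h) (.x , h') (z , h'') (inj₁ (refl , e)) =
  ≤-trans (+-monoʳ-≤ _ (step' h h' h'' e)) (≤-reflexive (+-suc _ _))
⊕-stepBounded step step' (x , h) (x' , .h) (z , h'') (inj₂ (e , refl)) = +-monoˡ-≤ _ (step x x' z e)

_∼_ : ℕ → ℕ → Set
i ∼ j = j ≡ suc i ⊎ i ≡ suc j

∣n-1+n∣≡1 : ∀ n → ∣ n - suc n ∣ ≡ 1
∣n-1+n∣≡1 zero    = refl
∣n-1+n∣≡1 (suc n) = ∣n-1+n∣≡1 n

∼⇒∣-∣≡1 : ∀ {i j} → i ∼ j → ∣ i - j ∣ ≡ 1
∼⇒∣-∣≡1 {i} (inj₁ refl) = ∣n-1+n∣≡1 i
∼⇒∣-∣≡1 {j = j} (inj₂ refl) = trans (∣-∣-comm (suc j) j) (∣n-1+n∣≡1 j)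

∼-irrefl : ∀ i → ¬ i ∼ i
∼-irrefl i (inj₁ eq) = m≢1+n+m i {0} eq
∼-irrefl i (inj₂ eq) = m≢1+n+m i {0} eq

≁2+ : ∀ i → ¬ i ∼ suc (suc i)
≁2+ i (inj₁ eq) = m≢1+n+m i {0} (sym (suc-injective eq))
≁2+ i (inj₂ eq) = m≢1+n+m i {2} eq

∼-commonNeighbour : ∀ i w → i ∼ w → w ∼ suc (suc i) → w ≡ suc i
∼-commonNeighbour i w _           (inj₁ eq) = suc-injective (sym eq)
∼-commonNeighbour i w (inj₁ refl) (inj₂ eq) = ⊥-elim (m≢1+n+m (suc i) {1} eq)
∼-commonNeighbour i w (inj₂ refl) (inj₂ eq) = ⊥-elim (m≢1+n+m w {3} eq)

pathDist : ∀ {n} → Fin n → Fin n → ℕ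
pathDist x y = ∣ toℕ x - toℕ y ∣

pathDist-stepBounded : ∀ {n} → StepBounded (P n) pathDist
pathDist-stepBounded x x' c e =
  ≤-trans (∣-∣-triangle (toℕ x) (toℕ x') (toℕ c)) (≤-reflexive (cong (_+ pathDist x' c) (∼⇒∣-∣≡1 e)))

Extremal : (n : ℕ) → Fin n → Set
Extremal n x = toℕ x ≡ 0 ⊎ suc (toℕ x) ≡ n

extremal-between⇒end : ∀ {n} {lo hi z : Fin n} → toℕ lo ≤ toℕ z → toℕ z ≤ toℕ hi →
                       Extremal n z → z ≡ lo ⊎ z ≡ hi
extremal-between⇒end {lo = lo} lo≤z z≤hi (inj₁ z≡0) =
  inj₁ (toℕ-injective (trans z≡0 (sym (n≤0⇒n≡0 (subst (toℕ lo ≤_) z≡0 lo≤z)))))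
extremal-between⇒end {hi = hi} lo≤z z≤hi (inj₂ z≡n-1) =
  inj₂ (toℕ-injective (≤-antisym z≤hi (s≤s⁻¹ (subst (toℕ hi <_) (sym z≡n-1) (toℕ<n hi)))))

extremal? : ∀ {n} (x : Fin n) → Dec (Extremal n x)
extremal? {n} x = (toℕ x ≟ 0) ⊎-dec (suc (toℕ x) ≟ n)

Between : ∀ {n} → Fin n → Fin n → Fin n → Set
Between lo hi z = toℕ lo ≤ toℕ z × toℕ z ≤ toℕ hi

ascendingWalk : ∀ {n} (x y : Fin n) k → toℕ y ≡ toℕ x + k → WalkWithin (P n) (Between x y) x y k
ascendingWalk x y zero y≡x+0 with toℕ-injective (trans y≡x+0 (+-identityʳ (toℕ x)))
... | refl = nil , (≤-refl , ≤-refl) List.∷ List.[]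
ascendingWalk {n} x y (suc k) y≡x+1+k =
  cons (inj₁ x'≡1+x) (proj₁ rest) , (≤-refl , <⇒≤ x<y) List.∷ List.map widen (proj₂ rest)
  where
  x<y : toℕ x < toℕ y
  x<y = subst (toℕ x <_) (trans (sym (+-suc (toℕ x) k)) (sym y≡x+1+k)) (m≤m+n (suc (toℕ x)) k)
  x' : Fin n
  x' = fromℕ< (<-≤-trans (s≤s x<y) (toℕ<n y))
  x'≡1+x : toℕ x' ≡ suc (toℕ x)
  x'≡1+x = toℕ-fromℕ< _
  rest : WalkWithin (P n) (Between x' y) x' y k
  rest = ascendingWalk x' y k (trans y≡x+1+k (trans (+-suc (toℕ x) k) (cong (_+ k) (sym x'≡1+x))))
  widen : ∀ {z} → Between x' y z → Between x y z
  widen (x'≤z , z≤y) = ≤-trans (n≤1+n _) (subst (_≤ _) x'≡1+x x'≤z) , z≤y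

descendingWalk : ∀ {n} (x y : Fin n) k → toℕ x ≡ toℕ y + k → WalkWithin (P n) (Between y x) x y k
descendingWalk x y zero x≡y+0 with toℕ-injective (trans x≡y+0 (+-identityʳ (toℕ y)))
... | refl = nil , (≤-refl , ≤-refl) List.∷ List.[]
descendingWalk {n} x y (suc k) x≡y+1+k =
  cons (inj₂ x≡1+x') (proj₁ rest) , (y≤x , ≤-refl) List.∷ List.map widen (proj₂ rest)
  where
  y<x : toℕ y < toℕ x
  y<x = subst (toℕ y <_) (trans (sym (+-suc (toℕ y) k)) (sym x≡y+1+k)) (m≤m+n (suc (toℕ y)) k)
  y≤x : toℕ y ≤ toℕ x
  y≤x = <⇒≤ y<x
  x' : Fin n
  x' = fromℕ< (≤-trans (≤-reflexive (sym (trans x≡y+1+k (+-suc (toℕ y) k)))) (<⇒≤ (toℕ<n x)))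
  x≡1+x' : toℕ x ≡ suc (toℕ x')
  x≡1+x' = trans x≡y+1+k (trans (+-suc (toℕ y) k) (cong suc (sym (toℕ-fromℕ< _))))
  rest : WalkWithin (P n) (Between y x') x' y k
  rest = descendingWalk x' y k (toℕ-fromℕ< _)
  widen : ∀ {z} → Between y x' z → Between y x z
  widen (y≤z , z≤x') = y≤z , ≤-trans z≤x' (subst (toℕ x' ≤_) (sym x≡1+x') (n≤1+n _))

P-avoidingWalk : ∀ {n} (x y : Fin n) → AvoidingWalk (P n) (Extremal n) x y (pathDist x y)
P-avoidingWalk x y with toℕ x ≤? toℕ y
... | yes x≤y = castWithin (sym (m≤n⇒∣m-n∣≡n∸m x≤y))
  (map₂ (List.map (λ (x≤z , z≤y) → extremal-between⇒end x≤z z≤y))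
        (ascendingWalk x y (toℕ y ∸ toℕ x) (sym (m+[n∸m]≡n x≤y))))
... | no x≰y = castWithin (sym (m≤n⇒∣n-m∣≡n∸m y≤x))
  (map₂ (List.map (λ (y≤z , z≤x) → swap ∘ extremal-between⇒end y≤z z≤x))
        (descendingWalk x y (toℕ x ∸ toℕ y) (sym (m+[n∸m]≡n y≤x))))
  where
  y≤x : toℕ y ≤ toℕ x
  y≤x = ≰⇒≥ x≰y

∣-∣-split : ∀ {i p j} → i ≤ p → p ≤ j → ∣ i - p ∣ + ∣ p - j ∣ ≡ ∣ i - j ∣
∣-∣-split {zero}  {p}     {j}     _         p≤j       =
  trans (cong (p +_) (m≤n⇒∣m-n∣≡n∸m p≤j)) (m+[n∸m]≡n p≤j)
∣-∣-split {suc i} {suc p} {suc j} (s≤s i≤p) (s≤s p≤j) = ∣-∣-split i≤p p≤j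

interiorPoint : ∀ {n i j} → 3 ≤ n → i < j → j < n → ∃ λ p → i ≤ p × p ≤ j × 0 < p × suc p < n
interiorPoint {i = zero}  3≤n (s≤s z≤n) _   = 1 , z≤n , s≤s z≤n , s≤s z≤n , 3≤n
interiorPoint {i = suc i} _   i<j       j<n = suc i , ≤-refl , <⇒≤ i<j , s≤s z≤n , ≤-trans (s≤s i<j) j<n

Pivot : ∀ {n} → Fin n → Fin n → Set
Pivot {n} x y = Σ (Fin n) λ p → ¬ Extremal n p × pathDist x p + pathDist p y ≡ pathDist x y

pivot-sym : ∀ {n} {x y : Fin n} → Pivot x y → Pivot y x
pivot-sym {x = x} {y} (p , interior , split) = p , interior , (begin
  ∣ toℕ y - toℕ p ∣ + ∣ toℕ p - toℕ x ∣ ≡⟨ +-comm ∣ toℕ y - toℕ p ∣ _ ⟩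
  ∣ toℕ p - toℕ x ∣ + ∣ toℕ y - toℕ p ∣ ≡⟨ cong₂ _+_ (∣-∣-comm (toℕ p) _) (∣-∣-comm (toℕ y) _) ⟩
  ∣ toℕ x - toℕ p ∣ + ∣ toℕ p - toℕ y ∣ ≡⟨ split ⟩
  ∣ toℕ x - toℕ y ∣                     ≡⟨ ∣-∣-comm (toℕ x) _ ⟩
  ∣ toℕ y - toℕ x ∣                     ∎)
  where open ≡-Reasoning

pivot< : ∀ {n} (x y : Fin n) → 3 ≤ n → toℕ x < toℕ y → Pivot x y
pivot< x y 3≤n x<y with interiorPoint 3≤n x<y (toℕ<n y)
... | p , x≤p , p≤y , 0<p , 1+p<n = fromℕ< (<⇒≤ 1+p<n) , interior , split
  where
  p≡ : toℕ (fromℕ< (<⇒≤ 1+p<n)) ≡ p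
  p≡ = toℕ-fromℕ< _
  interior : ¬ Extremal _ (fromℕ< (<⇒≤ 1+p<n))
  interior (inj₁ p≡0)   = <⇒≢ 0<p (sym (trans (sym p≡) p≡0))
  interior (inj₂ p≡n-1) = <⇒≢ 1+p<n (trans (cong suc (sym p≡)) p≡n-1)
  split : pathDist x (fromℕ< (<⇒≤ 1+p<n)) + pathDist (fromℕ< (<⇒≤ 1+p<n)) y ≡ pathDist x y
  split = subst (λ q → ∣ toℕ x - q ∣ + ∣ q - toℕ y ∣ ≡ pathDist x y) (sym p≡) (∣-∣-split x≤p p≤y)

pivot : ∀ {n} (x y : Fin n) → 3 ≤ n → x ≢ y → Pivot x y
pivot x y 3≤n x≢y with <-cmp (toℕ x) (toℕ y)
... | tri< x<y _ _ = pivot< x y 3≤n x<y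
... | tri≈ _ x≡y _ = ⊥-elim (x≢y (toℕ-injective x≡y))
... | tri> _ _ y<x = pivot-sym (pivot< y x 3≤n y<x)

□-avoidingWalk-fibre : ∀ {QG : V G → Set} {QH : V H → Set} x {h h'} →
                       AvoidingWalk H QH h h' k → AvoidingWalk (G □ H) (QG ⟨×⟩ QH) (x , h) (x , h') k
□-avoidingWalk-fibre x (w , ends) =
  mapʷ (□-fibreʳ x) w ,
  All-verts-mapʷ (□-fibreʳ x) w
    (List.map (λ onlyAtEnds (_ , q) → Sum.map (cong (x ,_)) (cong (x ,_)) (onlyAtEnds q)) ends)

□-avoidingWalk-via : ∀ {QG : V G → Set} {QH : V H → Set} {x p y h h' k₁ k₂ k₃} → ¬ QG p →
                     AvoidingWalk G QG x p k₁ → Walk H h h' k₂ → AvoidingWalk G QG p y k₃ →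
                     AvoidingWalk (G □ H) (QG ⟨×⟩ QH) (x , h) (y , h') (k₁ + (k₂ + k₃))
□-avoidingWalk-via {G = G} {H} {QG} {QH} {x} {p} {y} {h} {h'} p∉Q (w₁ , ends₁) w₂ (w₃ , ends₃) =
  w₁' ++ʷ (w₂' ++ʷ w₃') ,
  All-verts-++ʷ w₁' (w₂' ++ʷ w₃') ends₁' (All-verts-++ʷ w₂' w₃' ends₂' ends₃')
  where
  Q : V (G □ H) → Set
  Q = OnlyAtEnds (QG ⟨×⟩ QH) (x , h) (y , h')
  w₁' : Walk (G □ H) (x , h) (p , h) _
  w₁' = mapʷ (□-fibreˡ h) w₁
  w₂' : Walk (G □ H) (p , h) (p , h') _
  w₂' = mapʷ (□-fibreʳ p) w₂
  w₃' : Walk (G □ H) (p , h') (y , h') _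
  w₃' = mapʷ (□-fibreˡ h') w₃
  ends₁' : List.All Q (verts w₁')
  ends₁' = All-verts-mapʷ (□-fibreˡ h) w₁ (List.map (λ onlyAtEnds (q , _) →
    [ inj₁ ∘ cong (_, h) , (λ { refl → ⊥-elim (p∉Q q) }) ] (onlyAtEnds q)) ends₁)
  ends₂' : List.All Q (verts w₂')
  ends₂' = All-verts-mapʷ (□-fibreʳ p) w₂ (List.tabulate (λ _ (q , _) → ⊥-elim (p∉Q q)))
  ends₃' : List.All Q (verts w₃')
  ends₃' = All-verts-mapʷ (□-fibreˡ h') w₃ (List.map (λ onlyAtEnds (q , _) →
    [ (λ { refl → ⊥-elim (p∉Q q) }) , inj₂ ∘ cong (_, h') ] (onlyAtEnds q)) ends₃)

Corner : ∀ {m} (ns : Vec ℕ (suc m)) → V (□Paths ns) → Set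
Corner (n ∷ [])      = Extremal n
Corner (n ∷ n' ∷ ns) = Extremal n ⟨×⟩ Corner (n' ∷ ns)

dist : ∀ {m} (ns : Vec ℕ (suc m)) → V (□Paths ns) → V (□Paths ns) → ℕ
dist (n ∷ [])      = pathDist
dist (n ∷ n' ∷ ns) = pathDist ⊕ dist (n' ∷ ns)

dist-refl : ∀ {m} (ns : Vec ℕ (suc m)) a → dist ns a a ≡ 0
dist-refl (n ∷ [])      x       = ∣n-n∣≡0 (toℕ x)
dist-refl (n ∷ n' ∷ ns) (x , h) = cong₂ _+_ (∣n-n∣≡0 (toℕ x)) (dist-refl (n' ∷ ns) h)

dist-stepBounded : ∀ {m} (ns : Vec ℕ (suc m)) → StepBounded (□Paths ns) (dist ns)
dist-stepBounded (n ∷ [])      = pathDist-stepBounded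
dist-stepBounded (n ∷ n' ∷ ns) = ⊕-stepBounded pathDist-stepBounded (dist-stepBounded (n' ∷ ns))

□Paths-avoidingWalk : ∀ {m} (ns : Vec ℕ (suc m)) → All (3 ≤_) ns →
                      ∀ a b → AvoidingWalk (□Paths ns) (Corner ns) a b (dist ns a b)
□Paths-avoidingWalk (n ∷ [])      _            = P-avoidingWalk
□Paths-avoidingWalk (n ∷ n' ∷ ns) (3≤n ∷ 3≤ns) (x , h) (y , h') with x ≟ᶠ y
... | yes refl =
  castWithin (cong (_+ D) (sym (∣n-n∣≡0 (toℕ x)))) (□-avoidingWalk-fibre x rest)
  where
  D : ℕ
  D = dist (n' ∷ ns) h h'
  rest : AvoidingWalk _ (Corner (n' ∷ ns)) h h' D
  rest = □Paths-avoidingWalk (n' ∷ ns) 3≤ns h h'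
... | no x≢y with pivot x y 3≤n x≢y
...   | p , interior , split =
  castWithin lengths (□-avoidingWalk-via interior (P-avoidingWalk x p) (proj₁ rest) (P-avoidingWalk p y))
  where
  D : ℕ
  D = dist (n' ∷ ns) h h'
  rest : AvoidingWalk _ (Corner (n' ∷ ns)) h h' D
  rest = □Paths-avoidingWalk (n' ∷ ns) 3≤ns h h'
  lengths : pathDist x p + (D + pathDist p y) ≡ pathDist x y + D
  lengths = begin
    pathDist x p + (D + pathDist p y) ≡⟨ cong (pathDist x p +_) (+-comm D _) ⟩
    pathDist x p + (pathDist p y + D) ≡⟨ +-assoc (pathDist x p) _ D ⟨
    pathDist x p + pathDist p y + D   ≡⟨ cong (_+ D) split ⟩
    pathDist x y + D                  ∎
    where open ≡-Reasoning

record SoleMidpoint (G : Graph) (v : V G) : Set where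
  field
    a b    : V G
    a∼v    : Adj G a v
    v∼b    : Adj G v b
    a≁b    : ¬ Adj G a b
    a≢b    : a ≢ b
    a≢v    : a ≢ v
    b≢v    : b ≢ v
    unique : ∀ w → Adj G a w → Adj G w b → w ≡ v

Irreflexive : Graph → Set
Irreflexive G = ∀ x → ¬ Adj G x x

adj⇒≢ : Irreflexive G → ∀ {x y} → Adj G x y → x ≢ y
adj⇒≢ irr x∼y refl = irr _ x∼y

SoleMidpoint-□ˡ : ∀ {x} → SoleMidpoint G x → (h : V H) → SoleMidpoint (G □ H) (x , h)
SoleMidpoint-□ˡ {G = G} {H} {x} M h = record
  { a = a , h ; b = b , h
  ; a∼v = inj₂ (a∼v , refl) ; v∼b = inj₂ (v∼b , refl)
  ; a≁b = a'≁b' ; a≢b = a≢b ∘ cong proj₁ ; a≢v = a≢v ∘ cong proj₁ ; b≢v = b≢v ∘ cong proj₁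
  ; unique = unique' }
  where
  open SoleMidpoint M
  a'≁b' : ¬ Adj (G □ H) (a , h) (b , h)
  a'≁b' (inj₁ (a≡b , _)) = a≢b a≡b
  a'≁b' (inj₂ (a∼b , _)) = a≁b a∼b
  unique' : ∀ w → Adj (G □ H) (a , h) w → Adj (G □ H) w (b , h) → w ≡ (x , h)
  unique' _ (inj₁ (refl , _)) (inj₁ (a≡b , _))  = ⊥-elim (a≢b a≡b)
  unique' _ (inj₁ (refl , _)) (inj₂ (a∼b , _))  = ⊥-elim (a≁b a∼b)
  unique' _ (inj₂ (a∼b , _))  (inj₁ (refl , _)) = ⊥-elim (a≁b a∼b)
  unique' (z , _) (inj₂ (a∼z , _)) (inj₂ (z∼b , refl)) = cong (_, h) (unique z a∼z z∼b)

SoleMidpoint-□ʳ : ∀ {h} → Irreflexive G → SoleMidpoint H h → (x : V G) → SoleMidpoint (G □ H) (x , h)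
SoleMidpoint-□ʳ {G = G} {H} {h} irr M x = record
  { a = x , a ; b = x , b
  ; a∼v = inj₁ (refl , a∼v) ; v∼b = inj₁ (refl , v∼b)
  ; a≁b = a'≁b' ; a≢b = a≢b ∘ cong proj₂ ; a≢v = a≢v ∘ cong proj₂ ; b≢v = b≢v ∘ cong proj₂
  ; unique = unique' }
  where
  open SoleMidpoint M
  a'≁b' : ¬ Adj (G □ H) (x , a) (x , b)
  a'≁b' (inj₁ (_ , a∼b)) = a≁b a∼b
  a'≁b' (inj₂ (x∼x , _)) = irr x x∼x
  unique' : ∀ w → Adj (G □ H) (x , a) w → Adj (G □ H) w (x , b) → w ≡ (x , h)
  unique' (_ , z) (inj₁ (refl , a∼z)) (inj₁ (_ , z∼b))    = cong (x ,_) (unique z a∼z z∼b)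
  unique' _       (inj₁ (refl , _))   (inj₂ (x∼x , _))    = ⊥-elim (irr x x∼x)
  unique' _       (inj₂ (x∼x , _))    (inj₁ (refl , _))   = ⊥-elim (irr x x∼x)
  unique' _       (inj₂ (_ , refl))   (inj₂ (_ , a≡b))    = ⊥-elim (a≢b a≡b)

P-irreflexive : ∀ {n} → Irreflexive (P n)
P-irreflexive x = ∼-irrefl (toℕ x)

P-soleMidpoint : ∀ {n} {x : Fin n} → ¬ Extremal n x → SoleMidpoint (P n) x
P-soleMidpoint {n} {x} interior with toℕ x in x≡
... | zero  = ⊥-elim (interior (inj₁ refl))
... | suc j = record
  { a = a ; b = b
  ; a∼v = a∼x ; v∼b = x∼b
  ; a≁b = ≁2+ j ∘ subst₂ _∼_ a≡ b≡
  ; a≢b = λ a≡b → m≢1+n+m j {1} (trans (sym a≡) (trans (cong toℕ a≡b) b≡))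
  ; a≢v = adj⇒≢ {P n} P-irreflexive a∼x
  ; b≢v = ≢-sym (adj⇒≢ {P n} P-irreflexive x∼b)
  ; unique = λ w a∼w w∼b → toℕ-injective (trans
      (∼-commonNeighbour j (toℕ w) (subst (_∼ toℕ w) a≡ a∼w) (subst (toℕ w ∼_) b≡ w∼b)) (sym x≡)) }
  where
  2+j<n : suc (suc j) < n
  2+j<n = ≤∧≢⇒< (subst (_< n) x≡ (toℕ<n x)) (interior ∘ inj₂)
  a b : Fin n
  a = fromℕ< (<-trans (n<1+n j) (<-trans (n<1+n (suc j)) 2+j<n))
  b = fromℕ< 2+j<n
  a≡ : toℕ a ≡ j
  a≡ = toℕ-fromℕ< _
  b≡ : toℕ b ≡ suc (suc j)
  b≡ = toℕ-fromℕ< _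
  a∼x : Adj (P n) a x
  a∼x = subst₂ _∼_ (sym a≡) (sym x≡) (inj₁ refl)
  x∼b : Adj (P n) x b
  x∼b = subst₂ _∼_ (sym x≡) (sym b≡) (inj₁ refl)

module _ {G : Graph} {v : V G} (M : SoleMidpoint G v) where
  open SoleMidpoint M

  walk≤2-visits-midpoint : ∀ {Q : V G → Set} (w : Walk G a b k) → k ≤ 2 → List.All Q (verts w) → Q v
  walk≤2-visits-midpoint nil                          _ _ = ⊥-elim (a≢b refl)
  walk≤2-visits-midpoint (cons a∼b nil)               _ _ = ⊥-elim (a≁b a∼b)
  walk≤2-visits-midpoint {Q = Q} (cons a∼z (cons z∼b nil)) _ (_ List.∷ Qz List.∷ _) =
    subst Q (unique _ a∼z z∼b) Qz
  walk≤2-visits-midpoint (cons _ (cons _ (cons _ _))) (s≤s (s≤s ())) _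

  soleMidpoint-blocks : ∀ {X} → v ∈ X → ¬ Visible G X a b
  soleMidpoint-blocks v∈X (_ , w , shortest , ends) =
    [ a≢v ∘ sym , b≢v ∘ sym ] (walk≤2-visits-midpoint w (shortest (cons a∼v (cons v∼b nil))) ends v∈X)

nonCorner⇒soleMidpoint : ∀ {m} (ns : Vec ℕ (suc m)) {v} → ¬ Corner ns v → SoleMidpoint (□Paths ns) v
nonCorner⇒soleMidpoint (n ∷ [])      nonCorner = P-soleMidpoint nonCorner
nonCorner⇒soleMidpoint (n ∷ n' ∷ ns) {x , h} nonCorner with extremal? x
... | yes ext =
  SoleMidpoint-□ʳ {P n} P-irreflexive (nonCorner⇒soleMidpoint (n' ∷ ns) (nonCorner ∘ (ext ,_))) x
... | no ¬ext = SoleMidpoint-□ˡ (P-soleMidpoint ¬ext) h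

corner? : ∀ {m} (ns : Vec ℕ (suc m)) v → Dec (Corner ns v)
corner? (n ∷ [])      x       = extremal? x
corner? (n ∷ n' ∷ ns) (x , h) = extremal? x ×-dec corner? (n' ∷ ns) h

TMV⇒corner : ∀ {m} (ns : Vec ℕ (suc m)) {X} → IsTMV (□Paths ns) X → ∀ {v} → v ∈ X → Corner ns v
TMV⇒corner ns (_ , visible) {v} v∈X with corner? ns v
... | yes corner    = corner
... | no  nonCorner =
  ⊥-elim (soleMidpoint-blocks (nonCorner⇒soleMidpoint ns nonCorner) v∈X (visible _ _))

-- For n = 1 both ends are the same vertex.
extremes : ∀ n → List (Fin n)
extremes zero          = []
extremes (suc zero)    = Fin.zero ∷ []
extremes (suc (suc k)) = Fin.zero ∷ fromℕ (suc k) ∷ []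

extremes-unique : ∀ n → Unique (extremes n)
extremes-unique zero          = []
extremes-unique (suc zero)    = List.[] ∷ []
extremes-unique (suc (suc k)) = ((λ ()) List.∷ List.[]) ∷ List.[] ∷ []

extremal⇒∈extremes : ∀ {n} {x : Fin n} → Extremal n x → x ∈ extremes n
extremal⇒∈extremes {suc zero}    {Fin.zero}  _           = here refl
extremal⇒∈extremes {suc (suc k)} {Fin.zero}  _           = here refl
extremal⇒∈extremes {suc (suc k)} {Fin.suc x} (inj₂ x≡k) =
  there (here (toℕ-injective (trans (suc-injective x≡k) (sym (toℕ-fromℕ (suc k))))))

∈extremes⇒extremal : ∀ {n} {x : Fin n} → x ∈ extremes n → Extremal n x
∈extremes⇒extremal {suc zero}    (here refl)         = inj₁ refl
∈extremes⇒extremal {suc (suc k)} (here refl)         = inj₁ refl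
∈extremes⇒extremal {suc (suc k)} (there (here refl)) = inj₂ (cong suc (toℕ-fromℕ (suc k)))

length-extremes : ∀ {n} → 2 ≤ n → length (extremes n) ≡ 2
length-extremes (s≤s (s≤s z≤n)) = refl

corners : ∀ {m} (ns : Vec ℕ (suc m)) → List (V (□Paths ns))
corners (n ∷ [])      = extremes n
corners (n ∷ n' ∷ ns) = cartesianProduct (extremes n) (corners (n' ∷ ns))

corners-unique : ∀ {m} (ns : Vec ℕ (suc m)) → Unique (corners ns)
corners-unique (n ∷ [])      = extremes-unique n
corners-unique (n ∷ n' ∷ ns) = Unique.cartesianProduct⁺ (extremes-unique n) (corners-unique (n' ∷ ns))

corner⇒∈corners : ∀ {m} (ns : Vec ℕ (suc m)) {v} → Corner ns v → v ∈ corners ns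
corner⇒∈corners (n ∷ [])      ext            = extremal⇒∈extremes ext
corner⇒∈corners (n ∷ n' ∷ ns) (ext , corner) =
  ∈-cartesianProduct⁺ (extremal⇒∈extremes ext) (corner⇒∈corners (n' ∷ ns) corner)

∈corners⇒corner : ∀ {m} (ns : Vec ℕ (suc m)) {v} → v ∈ corners ns → Corner ns v
∈corners⇒corner (n ∷ [])      v∈ = ∈extremes⇒extremal v∈
∈corners⇒corner (n ∷ n' ∷ ns) v∈ =
  let x∈ , h∈ = ∈-cartesianProduct⁻ (extremes n) (corners (n' ∷ ns)) v∈
  in ∈extremes⇒extremal x∈ , ∈corners⇒corner (n' ∷ ns) h∈

length-cartesianProduct : {A B : Set} (xs : List A) (ys : List B) →
                          length (cartesianProduct xs ys) ≡ length xs * length ys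
length-cartesianProduct []       ys = refl
length-cartesianProduct (x ∷ xs) ys = begin
  length (map (x ,_) ys ++ cartesianProduct xs ys)
    ≡⟨ length-++ (map (x ,_) ys) ⟩
  length (map (x ,_) ys) + length (cartesianProduct xs ys)
    ≡⟨ cong₂ _+_ (length-map (x ,_) ys) (length-cartesianProduct xs ys) ⟩
  length ys + length xs * length ys
    ∎
  where open ≡-Reasoning

length-corners : ∀ {m} (ns : Vec ℕ (suc m)) → All (2 ≤_) ns → length (corners ns) ≡ 2 ^ suc m
length-corners (n ∷ [])                (2≤n ∷ [])    = length-extremes 2≤n
length-corners {suc m} (n ∷ n' ∷ ns) (2≤n ∷ 2≤ns) = begin
  length (cartesianProduct (extremes n) (corners (n' ∷ ns)))
    ≡⟨ length-cartesianProduct (extremes n) _ ⟩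
  length (extremes n) * length (corners (n' ∷ ns))
    ≡⟨ cong₂ _*_ (length-extremes 2≤n) (length-corners (n' ∷ ns) 2≤ns) ⟩
  2 * 2 ^ suc m
    ∎
  where open ≡-Reasoning

Unique-⊆⇒length≤ : {A : Set} {xs ys : List A} → Unique xs → xs ⊆ ys → length xs ≤ length ys
Unique-⊆⇒length≤ {xs = []}     _                _    = z≤n
Unique-⊆⇒length≤ {xs = x ∷ xs} {ys} (x∉xs ∷ uniq) x∷xs⊆ys with ∈-∃++ (x∷xs⊆ys (here refl))
... | us , vs , ys≡ = begin
  suc (length xs)             ≤⟨ s≤s (Unique-⊆⇒length≤ uniq xs⊆us++vs) ⟩
  suc (length (us ++ vs))     ≡⟨ cong suc (length-++ us) ⟩
  suc (length us + length vs) ≡⟨ +-suc (length us) _ ⟨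
  length us + length (x ∷ vs) ≡⟨ length-++ us ⟨
  length (us ++ x ∷ vs)       ≡⟨ cong length ys≡ ⟨
  length ys                   ∎
  where
  open ≤-Reasoning
  xs⊆us++vs : xs ⊆ (us ++ vs)
  xs⊆us++vs {v} v∈xs with ∈-++⁻ us (subst (v ∈_) ys≡ (x∷xs⊆ys (there v∈xs)))
  ... | inj₁ v∈us         = ∈-++⁺ˡ v∈us
  ... | inj₂ (here refl)  = ⊥-elim (List.lookup x∉xs v∈xs refl)
  ... | inj₂ (there v∈vs) = ∈-++⁺ʳ us v∈vs

μ⁻t≡-greatestTMV : (G : Graph) → DecidableEquality (V G) → (C : List (V G)) → IsTMV G C →
                   (∀ X → IsTMV G X → X ⊆ C) → μ⁻t≡ G (length C)
μ⁻t≡-greatestTMV G _≟_ C tmvC@(uniqueC , _) greatest = (C , maximal , refl) , minimum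
  where
  maximal : IsMaximalTMV G C
  maximal = tmvC , λ Y _ _ (v , v∈Y , v∉C) tmvY → v∉C (greatest Y tmvY v∈Y)
  minimum : ∀ X → IsMaximalTMV G X → length C ≤ length X
  minimum X (tmvX , noLargerTMV) = Unique-⊆⇒length≤ uniqueC C⊆X
    where
    C⊆X : C ⊆ X
    C⊆X {v} v∈C with _∈?_ _≟_ v X
    ... | yes v∈X = v∈X
    ... | no  v∉X = ⊥-elim (noLargerTMV C uniqueC (greatest X tmvX) (v , v∈C , v∉X) tmvC)

□Paths-≟ : ∀ {m} (ns : Vec ℕ (suc m)) → DecidableEquality (V (□Paths ns))
□Paths-≟ (n ∷ [])      = _≟ᶠ_
□Paths-≟ (n ∷ n' ∷ ns) = ≡-dec _≟ᶠ_ (□Paths-≟ (n' ∷ ns))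

corners-TMV : ∀ {m} (ns : Vec ℕ (suc m)) → All (3 ≤_) ns → IsTMV (□Paths ns) (corners ns)
corners-TMV ns 3≤ns = corners-unique ns , visible
  where
  visible : ∀ a b → Visible (□Paths ns) (corners ns) a b
  visible a b with □Paths-avoidingWalk ns 3≤ns a b
  ... | w , ends = dist ns a b , w , dist≤length (dist-refl ns) (dist-stepBounded ns) ,
                   List.map (_∘ ∈corners⇒corner ns) ends

proposition6p2 : (m : ℕ) (ns : Vec ℕ (suc m)) → 1 ≤ m → All (3 ≤_) ns →
    μ⁻t≡ (□Paths ns) (2 ^ suc m)
proposition6p2 m ns _ 3≤ns =
  subst (μ⁻t≡ (□Paths ns)) (length-corners ns (All.map (≤-trans (n≤1+n 2)) 3≤ns))
    (μ⁻t≡-greatestTMV (□Paths ns) (□Paths-≟ ns) (corners ns) (corners-TMV ns 3≤ns)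
      (λ X tmvX → corner⇒∈corners ns ∘ TMV⇒corner ns tmvX))
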